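{- Let $K$ be a pre-$H$-field with value group $\Gamma\neq\{0\}$ that has $1$-IVP. Then $\partial K=K$, $(K^{>})^\dagger=(K^{<})^\dagger$ is a convex subgroup of $K$, $\Psi:=\{\psi(\gamma):\gamma\in\Gamma^{\neq}\}$ has no largest element, and $\Psi$ is convex in $\Gamma$.
   Context: A pre-$H$-field is an ordered valued differential subfield of an $H$-field; $(\Gamma,\psi)$ denotes its $H$-asymptotic couple, with valuation ring $\mathcal{O}$ and maximal ideal $\mathfrak{o}$ of $\mathcal{O}$. $K$ has $1$-IVP if for every differential polynomial $P\in K\{Y\}$ of order at most $1$ and all $f<g$ in $K$ with $P(f)<0<P(g)$ there is $\phi\in K$ with $f<\phi<g$ and $P(\phi)=0$. Here $a^\dagger=a'/a$, $K^>=\{a\in K:a>0\}$, $K^<=\{a\in K:a<0\}$. -}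

module Defs where

open import Data.Nat using (ℕ; zero; suc)
open import Data.List using (List; []; _∷_)
open import Data.Product using (Σ; _×_; _,_)
open import Data.Sum using (_⊎_)
open import Relation.Binary.PropositionalEquality using (_≡_; _≢_)
open import Relation.Binary.Structures using (IsStrictTotalOrder)
open import Algebra.Structures using (IsCommutativeRing; IsAbelianGroup)

record OrderedAbelianGroup : Set₁ where
  infixl 6 _+_
  infix 4 _<_ _≤_
  field
    G                  : Set
    _+_                : G → G → G
    0g                 : G
    -_                 : G → G
    _<_                : G → G → Set
    isAbelianGroup     : IsAbelianGroup _≡_ _+_ 0g -_
    isStrictTotalOrder : IsStrictTotalOrder _≡_ _<_
    +-mono-<           : ∀ {a b} c → a < b → a + c < b + c

  _≤_ : G → G → Set
  a ≤ b = (a < b) ⊎ (a ≡ b)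

record OrderedValuedDiffField : Set₁ where
  infixl 6 _+_
  infixl 7 _*_
  infix 4 _<_ _≤_
  field
    K                  : Set
    _+_ _*_            : K → K → K
    -_                 : K → K
    0# 1#              : K
    _⁻¹                : K → K
    _<_                : K → K → Set
    isCommutativeRing  : IsCommutativeRing _≡_ _+_ _*_ -_ 0# 1#
    0≢1                : 0# ≢ 1#
    inverseʳ           : ∀ x → x ≢ 0# → x * (x ⁻¹) ≡ 1#
    isStrictTotalOrder : IsStrictTotalOrder _≡_ _<_
    +-mono-<           : ∀ {a b} c → a < b → a + c < b + c
    *-pos              : ∀ {a b} → 0# < a → 0# < b → 0# < a * b
    Γ                  : OrderedAbelianGroup
  open OrderedAbelianGroup Γ using (G) renaming (_+_ to _+Γ_; _<_ to _<Γ_; _≤_ to _≤Γ_)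
  field
    v                  : (x : K) → .(x ≢ 0#) → G
    v-mul              : ∀ x y (px : x ≢ 0#) (py : y ≢ 0#) (pxy : x * y ≢ 0#) →
                         v (x * y) pxy ≡ v x px +Γ v y py
    v-add              : ∀ x y (px : x ≢ 0#) (py : y ≢ 0#) (pxy : x + y ≢ 0#) →
                         (v x px ≤Γ v (x + y) pxy) ⊎ (v y py ≤Γ v (x + y) pxy)
    v-surj             : ∀ γ → Σ K λ x → Σ (x ≢ 0#) λ px → v x px ≡ γ
    ∂                  : K → K
    ∂-+                : ∀ x y → ∂ (x + y) ≡ ∂ x + ∂ y
    ∂-*                : ∀ x y → ∂ (x * y) ≡ ∂ x * y + x * ∂ y

  _≤_ : K → K → Set
  a ≤ b = (a < b) ⊎ (a ≡ b)

  _† : K → K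
  a † = ∂ a * (a ⁻¹)

  -- dominance relations: a ≼ b iff v a ≥ v b (with v 0 = ∞),
  -- a ≺ b iff v a > v b
  _≼_ : K → K → Set
  a ≼ b = (a ≡ 0#) ⊎ Σ (a ≢ 0#) λ pa → Σ (b ≢ 0#) λ pb → v b pb ≤Γ v a pa

  _≺_ : K → K → Set
  a ≺ b = Σ (b ≢ 0#) λ pb → (a ≡ 0#) ⊎ Σ (a ≢ 0#) λ pa → v b pb <Γ v a pa

  𝒪 : K → Set
  𝒪 a = a ≼ 1#

  -- Ψ = { ψ(γ) : γ ∈ Γ^≠ },  ψ(v g) = v(g†)
  InΨ : G → Set
  InΨ δ = Σ K λ g → Σ (g ≢ 0#) λ pg → Σ (v g pg ≢ OrderedAbelianGroup.0g Γ) λ _ →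
          Σ (g † ≢ 0#) λ pd → v (g †) pd ≡ δ

  -- differential polynomials of order ≤ 1: finite sums  Σ c · Y^i · (Y')^j
  DiffPoly1 : Set
  DiffPoly1 = List (K × ℕ × ℕ)

  pow : K → ℕ → K
  pow a zero    = 1#
  pow a (suc n) = a * pow a n

  eval1 : DiffPoly1 → K → K
  eval1 []                    y = 0#
  eval1 ((c , i , j) ∷ P)     y = c * pow y i * pow (∂ y) j + eval1 P y



record IsPreHField (F : OrderedValuedDiffField) : Set where
  open OrderedValuedDiffField F using () renaming (K to K'; _<_ to _<'_; _≤_ to _≤'_; 0# to z; 1# to o; ∂ to d; _≼_ to _≼'_; _≺_ to _≺'_; _† to dag; 𝒪 to O)
  field
    pdv        : ∀ f g → f ≢ z → g ≢ z → f ≼' o → g ≺' o → d f ≺' dag g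
    𝒪-convex   : ∀ a b c → O a → O b → a ≤' c → c ≤' b → O c
    pos-deriv  : ∀ f → (∀ a → O a → a <' f) → z <' d f

record PreHField : Set₁ where
  field
    field'    : OrderedValuedDiffField
    isPreH    : IsPreHField field'
  open OrderedValuedDiffField field' public

Has1IVP : OrderedValuedDiffField → Set
Has1IVP F = ∀ (P : DiffPoly1) f g → f < g → eval1 P f < 0# → 0# < eval1 P g →
            Σ K λ φ → (f < φ) × (φ < g) × (eval1 P φ ≡ 0#)
  where open OrderedValuedDiffField F

DagPos : (F : OrderedValuedDiffField) → OrderedValuedDiffField.K F → Set
DagPos F a = Σ K λ f → (0# < f) × (f † ≡ a)
  where open OrderedValuedDiffField F

DagNeg : (F : OrderedValuedDiffField) → OrderedValuedDiffField.K F → Set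
DagNeg F a = Σ K λ f → (f < 0#) × (f † ≡ a)
  where open OrderedValuedDiffField F

IsConvexSubgroup : (F : OrderedValuedDiffField) → (OrderedValuedDiffField.K F → Set) → Set
IsConvexSubgroup F S =
  S 0# × (∀ a b → S a → S b → S (a + b)) × (∀ a → S a → S (- a)) ×
  (∀ a b c → S a → S b → a ≤ c → c ≤ b → S c)
  where open OrderedValuedDiffField F

NontrivialValueGroup : OrderedValuedDiffField → Set
NontrivialValueGroup F = Σ G λ γ → γ ≢ 0g
  where open OrderedValuedDiffField F using (Γ)
        open OrderedAbelianGroup Γ using (G; 0g)

Lemma1p1Conclusion : OrderedValuedDiffField → Set
Lemma1p1Conclusion F =
  (∀ a → Σ K λ b → ∂ b ≡ a)
  × (∀ a → (DagPos F a → DagNeg F a) × (DagNeg F a → DagPos F a))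
  × IsConvexSubgroup F (DagPos F)
  × (∀ δ → InΨ δ → Σ G λ δ' → InΨ δ' × (δ <Γ δ'))
  × (∀ a b c → InΨ a → InΨ b → a ≤Γ c → c ≤Γ b → InΨ c)
  where open OrderedValuedDiffField F
        open OrderedAbelianGroup Γ using (G) renaming (_<_ to _<Γ_; _≤_ to _≤Γ_)

module Submission where

-- After general algebra (an integer-coefficient ring solver, facts about
-- ordered abelian groups, ordered fields, derivations and valuations) the
-- argument runs as follows.
--  * In a pre-H-field, v s < v y with s > 0 forces -s < y < s (convexity
--    of 𝒪), elements above 𝒪 have positive derivative, and (PDV) reads
--    v(g†) < v(f') for f ≼ 1, g ≺ 1.
--  * 1-IVP is used with two linear equations: Y' - a (antiderivatives:
--    for y > 0 large enough, y' dominates a, so Y' - a changes sign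
--    between -y and y) and Y' - cY (if a = f†, b = g† with f, g > 0 and
--    a < c < b, then Y' - cY changes sign between f and g, so c ∈ (K^>)†).
--  * For Ψ: given δ = v(h†) with h ≺ 1, an antiderivative y of h† is ≻ 1
--    by (PDV), and ψ(v y) = δ - v y > δ.  Convexity: every y with value
--    between two elements of Ψ lies in the convex group (K^>)†, so y = h†,
--    and (PDV) forces v h ≠ 0.

open import Defs
open import Level using (0ℓ)
open import Data.Nat as ℕ using (zero; suc)
import Data.Nat.Properties as ℕP
open import Data.Integer as ℤ using (ℤ; -[1+_]; _⊖_)
import Data.Integer.Properties as ℤP
open import Data.Maybe using (Maybe; just; nothing)
open import Data.List using ([]; _∷_)
open import Data.Product using (Σ; _×_; _,_)
open import Data.Sum using (_⊎_; inj₁; inj₂)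
open import Data.Empty using (⊥-elim)
open import Relation.Nullary using (¬_; yes; no)
open import Relation.Binary.PropositionalEquality
open import Relation.Binary.Definitions using (tri<; tri≈; tri>)
open import Relation.Binary.Structures using (IsStrictTotalOrder)
open import Algebra.Bundles using (CommutativeRing; AbelianGroup)
open import Algebra.Structures using (IsCommutativeRing; IsAbelianGroup)
open import Algebra.Solver.Ring.AlmostCommutativeRing
  using (_-Raw-AlmostCommutative⟶_; fromCommutativeRing)

-- The integers act through the
-- canonical homomorphism ℤ → A; comparing integer coefficients lets the
-- solver normalise expressions that involve subtraction.
module IntegerCoefficientSolver
  {A : Set} {add mul : A → A → A} {neg : A → A} {z o : A}
  (isCommutativeRing : IsCommutativeRing _≡_ add mul neg z o) where

  commutativeRing : CommutativeRing 0ℓ 0ℓ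
  commutativeRing = record { isCommutativeRing = isCommutativeRing }

  open CommutativeRing commutativeRing
    using (_+_; _*_; -_; _-_; 0#; 1#; ring; semiring; +-identityˡ; +-identityʳ; +-assoc; +-comm; -‿inverseʳ)
  open import Algebra.Properties.Ring ring
    using (-0#≈0#; -‿+-comm; -‿involutive; -‿distribˡ-*; -‿distribʳ-*)
  open import Algebra.Properties.Semiring.Mult.TCOptimised semiring
    renaming (_×_ to _×ᴬ_) using (1+×; ×-homo-+; ×1-homo-*)
  open ≡-Reasoning

  -- the image of an integer in A; the optimised multiple n ×ᴬ 1# makes
  -- 1 ×ᴬ 1# = 1# hold definitionally, so the solver's constant 1 denotes 1#
  ⟦_⟧ℤ : ℤ → A
  ⟦ ℤ.+ n ⟧ℤ    = n ×ᴬ 1#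
  ⟦ -[1+ n ] ⟧ℤ = - (suc n ×ᴬ 1#)

  cancel-one : ∀ a b → (1# + a) - (1# + b) ≡ a - b
  cancel-one a b = begin
    (1# + a) + - (1# + b)   ≡⟨ cong ((1# + a) +_) (sym (-‿+-comm 1# b)) ⟩
    (1# + a) + (- 1# + - b) ≡⟨ cong (_+ (- 1# + - b)) (+-comm 1# a) ⟩
    (a + 1#) + (- 1# + - b) ≡⟨ +-assoc a 1# _ ⟩
    a + (1# + (- 1# + - b)) ≡⟨ cong (a +_) (sym (+-assoc 1# (- 1#) (- b))) ⟩
    a + ((1# + - 1#) + - b) ≡⟨ cong (λ t → a + (t + - b)) (-‿inverseʳ 1#) ⟩
    a + (0# + - b)          ≡⟨ cong (a +_) (+-identityˡ _) ⟩
    a - b                   ∎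

  ⊖-homo : ∀ m n → ⟦ m ⊖ n ⟧ℤ ≡ m ×ᴬ 1# - n ×ᴬ 1#
  ⊖-homo zero    zero    = sym (-‿inverseʳ 0#)
  ⊖-homo zero    (suc n) = sym (+-identityˡ _)
  ⊖-homo (suc m) zero    = sym (trans (cong (suc m ×ᴬ 1# +_) -0#≈0#) (+-identityʳ _))
  ⊖-homo (suc m) (suc n) = begin
    ⟦ suc m ⊖ suc n ⟧ℤ              ≡⟨ cong ⟦_⟧ℤ (ℤP.[1+m]⊖[1+n]≡m⊖n m n) ⟩
    ⟦ m ⊖ n ⟧ℤ                      ≡⟨ ⊖-homo m n ⟩
    m ×ᴬ 1# - n ×ᴬ 1#               ≡⟨ sym (cancel-one _ _) ⟩
    (1# + m ×ᴬ 1#) - (1# + n ×ᴬ 1#) ≡⟨ sym (cong₂ _-_ (1+× m 1#) (1+× n 1#)) ⟩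
    suc m ×ᴬ 1# - suc n ×ᴬ 1#       ∎

  +-homo : ∀ i j → ⟦ i ℤ.+ j ⟧ℤ ≡ ⟦ i ⟧ℤ + ⟦ j ⟧ℤ
  +-homo (ℤ.+ m)  (ℤ.+ n)  = ×-homo-+ 1# m n
  +-homo (ℤ.+ m)  -[1+ n ] = ⊖-homo m (suc n)
  +-homo -[1+ m ] (ℤ.+ n)  = trans (⊖-homo n (suc m)) (+-comm _ _)
  +-homo -[1+ m ] -[1+ n ] = begin
    - (suc (suc (m ℕ.+ n)) ×ᴬ 1#)     ≡⟨ cong (λ k → - (k ×ᴬ 1#)) (sym (ℕP.+-suc (suc m) n)) ⟩
    - ((suc m ℕ.+ suc n) ×ᴬ 1#)       ≡⟨ cong -_ (×-homo-+ 1# (suc m) (suc n)) ⟩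
    - (suc m ×ᴬ 1# + suc n ×ᴬ 1#)     ≡⟨ sym (-‿+-comm _ _) ⟩
    - (suc m ×ᴬ 1#) + - (suc n ×ᴬ 1#) ∎

  neg-homo : ∀ i → ⟦ ℤ.- i ⟧ℤ ≡ - ⟦ i ⟧ℤ
  neg-homo (ℤ.+ zero)  = sym -0#≈0#
  neg-homo (ℤ.+ suc n) = refl
  neg-homo -[1+ n ]    = sym (-‿involutive _)

  *-homo-nonneg : ∀ m j → ⟦ ℤ.+ m ℤ.* j ⟧ℤ ≡ m ×ᴬ 1# * ⟦ j ⟧ℤ
  *-homo-nonneg m (ℤ.+ n) = trans (cong ⟦_⟧ℤ (sym (ℤP.pos-* m n))) (×1-homo-* m n)
  *-homo-nonneg m -[1+ n ] = begin
    ⟦ ℤ.+ m ℤ.* ℤ.- (ℤ.+ suc n) ⟧ℤ ≡⟨ cong ⟦_⟧ℤ (sym (ℤP.neg-distribʳ-* (ℤ.+ m) (ℤ.+ suc n))) ⟩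
    ⟦ ℤ.- (ℤ.+ m ℤ.* ℤ.+ suc n) ⟧ℤ ≡⟨ neg-homo (ℤ.+ m ℤ.* ℤ.+ suc n) ⟩
    - ⟦ ℤ.+ m ℤ.* ℤ.+ suc n ⟧ℤ      ≡⟨ cong -_ (*-homo-nonneg m (ℤ.+ suc n)) ⟩
    - (m ×ᴬ 1# * (suc n ×ᴬ 1#))    ≡⟨ -‿distribʳ-* _ _ ⟩
    m ×ᴬ 1# * - (suc n ×ᴬ 1#)      ∎

  *-homo : ∀ i j → ⟦ i ℤ.* j ⟧ℤ ≡ ⟦ i ⟧ℤ * ⟦ j ⟧ℤ
  *-homo (ℤ.+ m)  j = *-homo-nonneg m j
  *-homo -[1+ m ] j = begin
    ⟦ ℤ.- (ℤ.+ suc m) ℤ.* j ⟧ℤ ≡⟨ cong ⟦_⟧ℤ (sym (ℤP.neg-distribˡ-* (ℤ.+ suc m) j)) ⟩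
    ⟦ ℤ.- (ℤ.+ suc m ℤ.* j) ⟧ℤ ≡⟨ neg-homo (ℤ.+ suc m ℤ.* j) ⟩
    - ⟦ ℤ.+ suc m ℤ.* j ⟧ℤ      ≡⟨ cong -_ (*-homo-nonneg (suc m) j) ⟩
    - (suc m ×ᴬ 1# * ⟦ j ⟧ℤ)   ≡⟨ -‿distribˡ-* _ _ ⟩
    - (suc m ×ᴬ 1#) * ⟦ j ⟧ℤ   ∎

  homomorphism : ℤ.+-*-rawRing -Raw-AlmostCommutative⟶ fromCommutativeRing commutativeRing
  homomorphism = record
    { ⟦_⟧ = ⟦_⟧ℤ ; +-homo = +-homo ; *-homo = *-homo ; -‿homo = neg-homo
    ; 0-homo = refl ; 1-homo = refl }

  -- the solver only needs to recognise equal integer coefficients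
  equal-images : ∀ i j → Maybe (⟦ i ⟧ℤ ≡ ⟦ j ⟧ℤ)
  equal-images i j with i ℤP.≟ j
  ... | yes i≡j = just (cong ⟦_⟧ℤ i≡j)
  ... | no  _   = nothing

  open import Algebra.Solver.Ring ℤ.+-*-rawRing (fromCommutativeRing commutativeRing)
    homomorphism equal-images public

  0ᶜ 1ᶜ : ∀ {n} → Polynomial n
  0ᶜ = con (ℤ.+ 0)
  1ᶜ = con (ℤ.+ 1)

module OrderedGroupFacts (Γ : OrderedAbelianGroup) where
  open OrderedAbelianGroup Γ
  open IsStrictTotalOrder isStrictTotalOrder public using (compare) renaming (trans to <-trans)
  open IsAbelianGroup isAbelianGroup public using (identityˡ; inverseʳ)
  open IsAbelianGroup isAbelianGroup using (comm; identityʳ; inverseˡ; assoc)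

  abelianGroup : AbelianGroup 0ℓ 0ℓ
  abelianGroup = record { isAbelianGroup = isAbelianGroup }

  open import Algebra.Properties.AbelianGroup abelianGroup public
    using (inverseʳ-unique; identityʳ-unique; ε⁻¹≈ε)

  <-irrefl : ∀ {a} → ¬ (a < a)
  <-irrefl = IsStrictTotalOrder.irrefl isStrictTotalOrder refl

  <-≤-trans : ∀ {a b c} → a < b → b ≤ c → a < c
  <-≤-trans a<b (inj₁ b<c)  = <-trans a<b b<c
  <-≤-trans a<b (inj₂ refl) = a<b

  ≤-<-trans : ∀ {a b c} → a ≤ b → b < c → a < c
  ≤-<-trans (inj₁ a<b)  b<c = <-trans a<b b<c
  ≤-<-trans (inj₂ refl) b<c = b<c

  +-monoˡ-< : ∀ {a b} c → a < b → c + a < c + b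
  +-monoˡ-< {a} {b} c a<b = subst₂ _<_ (comm a c) (comm b c) (+-mono-< c a<b)

  +-mono-≤-< : ∀ {a b c d} → a ≤ b → c < d → a + c < b + d
  +-mono-≤-< (inj₁ a<b)  c<d = <-trans (+-mono-< _ a<b) (+-monoˡ-< _ c<d)
  +-mono-≤-< (inj₂ refl) c<d = +-monoˡ-< _ c<d

  <⊎≥ : ∀ a b → (a < b) ⊎ (b ≤ a)
  <⊎≥ a b with compare a b
  ... | tri< a<b _ _ = inj₁ a<b
  ... | tri≈ _ a≡b _ = inj₂ (inj₂ (sym a≡b))
  ... | tri> _ _ b<a = inj₂ (inj₁ b<a)

  neg-antitone : ∀ {a b} → a < b → - b < - a
  neg-antitone {a} {b} a<b = subst₂ _<_ (cancelˡ a (- b)) cancel-b (+-mono-< (- a + - b) a<b)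
    where
      cancelˡ : ∀ x y → x + (- x + y) ≡ y
      cancelˡ x y = trans (sym (assoc _ _ _)) (trans (cong (_+ y) (inverseʳ x)) (identityˡ y))
      cancel-b : b + (- a + - b) ≡ - a
      cancel-b = trans (cong (b +_) (comm _ _)) (cancelˡ b (- a))

  neg-of-pos : ∀ {a} → 0g < a → - a < 0g
  neg-of-pos 0<a = subst (_ <_) ε⁻¹≈ε (neg-antitone 0<a)

  neg-of-neg : ∀ {a} → a < 0g → 0g < - a
  neg-of-neg a<0 = subst (_< _) ε⁻¹≈ε (neg-antitone a<0)

  double≡0⇒≡0 : ∀ {a} → a + a ≡ 0g → a ≡ 0g
  double≡0⇒≡0 {a} a+a≡0 with compare a 0g
  ... | tri≈ _ a≡0 _ = a≡0
  ... | tri< a<0 _ _ = ⊥-elim (<-irrefl (subst (_< 0g) a+a≡0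
          (<-trans (+-mono-< a a<0) (subst (_< 0g) (sym (identityˡ a)) a<0))))
  ... | tri> _ _ 0<a = ⊥-elim (<-irrefl (subst (0g <_) a+a≡0
          (<-trans (subst (0g <_) (sym (identityˡ a)) 0<a) (+-mono-< a 0<a))))

  sub-add : ∀ a b → (b + - a) + a ≡ b
  sub-add a b = trans (assoc _ _ _) (trans (cong (b +_) (inverseˡ a)) (identityʳ b))

  negative-below : ∀ δ {w} → w < 0g → Σ G λ γ → (γ < 0g) × (γ ≤ δ)
  negative-below δ {w} w<0 with compare δ 0g
  ... | tri< δ<0 _ _  = δ , δ<0 , inj₂ refl
  ... | tri≈ _ δ≡0 _  = w , w<0 , inj₁ (subst (w <_) (sym δ≡0) w<0)
  ... | tri> _ _ 0<δ  = w , w<0 , inj₁ (<-trans w<0 0<δ)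

  negative-element : ∀ {γ} → γ ≢ 0g → Σ G λ w → w < 0g
  negative-element {γ} γ≢0 with compare γ 0g
  ... | tri< γ<0 _ _ = γ , γ<0
  ... | tri≈ _ γ≡0 _ = ⊥-elim (γ≢0 γ≡0)
  ... | tri> _ _ 0<γ = - γ , neg-of-pos 0<γ

module OrderedFieldFacts (F : OrderedValuedDiffField) where
  open OrderedValuedDiffField F
  open IntegerCoefficientSolver isCommutativeRing using (solve; _:+_; _:*_; :-_; _:=_; 0ᶜ; 1ᶜ)
  open ≡-Reasoning

  additiveGroup : OrderedAbelianGroup
  additiveGroup = record
    { G = K ; _+_ = _+_ ; 0g = 0# ; -_ = -_ ; _<_ = _<_
    ; isAbelianGroup = IsCommutativeRing.+-isAbelianGroup isCommutativeRing
    ; isStrictTotalOrder = isStrictTotalOrder ; +-mono-< = +-mono-< }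

  open OrderedGroupFacts additiveGroup public
    using (compare; <-trans; <-irrefl; neg-antitone; neg-of-pos; neg-of-neg)

  <-asym : ∀ {x y} → x < y → ¬ (y < x)
  <-asym x<y y<x = <-irrefl (<-trans x<y y<x)

  pos⇒≢0 : ∀ {x} → 0# < x → x ≢ 0#
  pos⇒≢0 0<x x≡0 = <-irrefl (subst (0# <_) x≡0 0<x)

  neg⇒≢0 : ∀ {x} → x < 0# → x ≢ 0#
  neg⇒≢0 x<0 x≡0 = <-irrefl (subst (_< 0#) x≡0 x<0)

  pos-or-neg-pos : ∀ {x} → x ≢ 0# → (0# < x) ⊎ (0# < - x)
  pos-or-neg-pos {x} x≢0 with compare 0# x
  ... | tri< 0<x _ _ = inj₁ 0<x
  ... | tri≈ _ 0≡x _ = ⊥-elim (x≢0 (sym 0≡x))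
  ... | tri> _ _ x<0 = inj₂ (neg-of-neg x<0)

  1≢0 : 1# ≢ 0#
  1≢0 1≡0 = 0≢1 (sym 1≡0)

  <⇒0<difference : ∀ {a b} → a < b → 0# < b + - a
  <⇒0<difference {a} {b} a<b =
    subst (_< b + - a) (solve 1 (λ a → a :+ :- a := 0ᶜ) refl a) (+-mono-< (- a) a<b)

  <⇒difference<0 : ∀ {a b} → a < b → a + - b < 0#
  <⇒difference<0 {a} {b} a<b =
    subst (a + - b <_) (solve 1 (λ b → b :+ :- b := 0ᶜ) refl b) (+-mono-< (- b) a<b)

  0<difference⇒< : ∀ {a b} → 0# < b + - a → a < b
  0<difference⇒< {a} {b} 0<b-a =
    subst₂ _<_ (solve 1 (λ a → 0ᶜ :+ a := a) refl a)
               (solve 2 (λ a b → b :+ :- a :+ a := b) refl a b) (+-mono-< a 0<b-a)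

  pos*neg<0 : ∀ {a b} → 0# < a → b < 0# → a * b < 0#
  pos*neg<0 {a} {b} 0<a b<0 =
    subst (_< 0#) (solve 2 (λ a b → :- (a :* :- b) := a :* b) refl a b)
          (neg-of-pos (*-pos 0<a (neg-of-neg b<0)))

  *-monoʳ-< : ∀ {a b c} → 0# < c → a < b → a * c < b * c
  *-monoʳ-< {a} {b} {c} 0<c a<b = 0<difference⇒< (subst (0# <_)
    (solve 3 (λ a b c → (b :+ :- a) :* c := b :* c :+ :- (a :* c)) refl a b c)
    (*-pos (<⇒0<difference a<b) 0<c))

  -- 1 = (-1)(-1) rules out 1 < 0
  0<1 : 0# < 1#
  0<1 with compare 0# 1#
  ... | tri< 0<1 _ _ = 0<1
  ... | tri≈ _ 0≡1 _ = ⊥-elim (0≢1 0≡1)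
  ... | tri> _ _ 1<0 = ⊥-elim (<-asym 1<0 (subst (0# <_)
          (solve 0 (:- 1ᶜ :* :- 1ᶜ := 1ᶜ) refl) (*-pos (neg-of-neg 1<0) (neg-of-neg 1<0))))

  *-≢0 : ∀ {x y} → x ≢ 0# → y ≢ 0# → x * y ≢ 0#
  *-≢0 {x} {y} x≢0 y≢0 xy≡0 = y≢0 (begin
    y              ≡⟨ solve 1 (λ y → y := 1ᶜ :* y) refl y ⟩
    1# * y         ≡⟨ cong (_* y) (sym (inverseʳ x x≢0)) ⟩
    (x * x ⁻¹) * y ≡⟨ solve 3 (λ x i y → (x :* i) :* y := (x :* y) :* i) refl x (x ⁻¹) y ⟩
    (x * y) * x ⁻¹ ≡⟨ cong (_* x ⁻¹) xy≡0 ⟩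
    0# * x ⁻¹      ≡⟨ solve 1 (λ i → 0ᶜ :* i := 0ᶜ) refl _ ⟩
    0#             ∎)

  ⁻¹-≢0 : ∀ {x} → x ≢ 0# → x ⁻¹ ≢ 0#
  ⁻¹-≢0 {x} x≢0 x⁻¹≡0 = 0≢1 (begin
    0#         ≡⟨ solve 1 (λ x → 0ᶜ := x :* 0ᶜ) refl x ⟩
    x * 0#     ≡⟨ cong (x *_) (sym x⁻¹≡0) ⟩
    x * x ⁻¹   ≡⟨ inverseʳ x x≢0 ⟩
    1#         ∎)

  neg-≢0 : ∀ {x} → x ≢ 0# → - x ≢ 0#
  neg-≢0 {x} x≢0 -x≡0 = x≢0 (begin
    x       ≡⟨ solve 1 (λ x → x := :- (:- x)) refl x ⟩
    - (- x) ≡⟨ cong -_ -x≡0 ⟩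
    - 0#    ≡⟨ solve 0 (:- 0ᶜ := 0ᶜ) refl ⟩
    0#      ∎)

  ⁻¹-pos : ∀ {x} → 0# < x → 0# < x ⁻¹
  ⁻¹-pos {x} 0<x with compare 0# (x ⁻¹)
  ... | tri< 0<x⁻¹ _ _ = 0<x⁻¹
  ... | tri≈ _ 0≡x⁻¹ _ = ⊥-elim (⁻¹-≢0 (pos⇒≢0 0<x) (sym 0≡x⁻¹))
  ... | tri> _ _ x⁻¹<0 = ⊥-elim (<-asym 0<1
          (subst (_< 0#) (inverseʳ x (pos⇒≢0 0<x)) (pos*neg<0 0<x x⁻¹<0)))

  quotient-unique : ∀ {x d e} → x ≢ 0# → x * d ≡ e → e * x ⁻¹ ≡ d
  quotient-unique {x} {d} {e} x≢0 xd≡e = begin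
    e * x ⁻¹       ≡⟨ cong (_* x ⁻¹) (sym xd≡e) ⟩
    (x * d) * x ⁻¹ ≡⟨ solve 3 (λ x d i → (x :* d) :* i := d :* (x :* i)) refl x d (x ⁻¹) ⟩
    d * (x * x ⁻¹) ≡⟨ cong (d *_) (inverseʳ x x≢0) ⟩
    d * 1#         ≡⟨ solve 1 (λ d → d :* 1ᶜ := d) refl d ⟩
    d              ∎

module DerivationFacts (F : OrderedValuedDiffField) where
  open OrderedValuedDiffField F
  open OrderedFieldFacts F
  open IntegerCoefficientSolver isCommutativeRing
    using (commutativeRing; solve; _:+_; _:*_; :-_; _:=_; 0ᶜ; 1ᶜ)
  open CommutativeRing commutativeRing using (ring)
  open import Algebra.Properties.Ring ring using (+-identityʳ-unique; +-inverseʳ-unique)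
  open ≡-Reasoning

  ∂-zero : ∂ 0# ≡ 0#
  ∂-zero = +-identityʳ-unique (∂ 0#) (∂ 0#) (sym (begin
    ∂ 0#           ≡⟨ cong ∂ (solve 0 (0ᶜ := 0ᶜ :+ 0ᶜ) refl) ⟩
    ∂ (0# + 0#)    ≡⟨ ∂-+ 0# 0# ⟩
    ∂ 0# + ∂ 0#    ∎))

  ∂-one : ∂ 1# ≡ 0#
  ∂-one = +-identityʳ-unique (∂ 1#) (∂ 1#) (sym (begin
    ∂ 1#                      ≡⟨ cong ∂ (solve 0 (1ᶜ := 1ᶜ :* 1ᶜ) refl) ⟩
    ∂ (1# * 1#)               ≡⟨ ∂-* 1# 1# ⟩
    ∂ 1# * 1# + 1# * ∂ 1#     ≡⟨ solve 1 (λ d → d :* 1ᶜ :+ 1ᶜ :* d := d :+ d) refl (∂ 1#) ⟩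
    ∂ 1# + ∂ 1#               ∎))

  ∂-neg : ∀ x → ∂ (- x) ≡ - ∂ x
  ∂-neg x = +-inverseʳ-unique (∂ x) (∂ (- x)) (begin
    ∂ x + ∂ (- x)  ≡⟨ sym (∂-+ x (- x)) ⟩
    ∂ (x + - x)    ≡⟨ cong ∂ (solve 1 (λ x → x :+ :- x := 0ᶜ) refl x) ⟩
    ∂ 0#           ≡⟨ ∂-zero ⟩
    0#             ∎)

  †-spec : ∀ {x} → x ≢ 0# → x * x † ≡ ∂ x
  †-spec {x} x≢0 = begin
    x * (∂ x * x ⁻¹) ≡⟨ solve 3 (λ x d i → x :* (d :* i) := d :* (x :* i)) refl x (∂ x) (x ⁻¹) ⟩
    ∂ x * (x * x ⁻¹) ≡⟨ cong (∂ x *_) (inverseʳ x x≢0) ⟩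
    ∂ x * 1#         ≡⟨ solve 1 (λ d → d :* 1ᶜ := d) refl (∂ x) ⟩
    ∂ x              ∎

  †-unique : ∀ {x d} → x ≢ 0# → x * d ≡ ∂ x → x † ≡ d
  †-unique = quotient-unique

  †-mul : ∀ {x y} → x ≢ 0# → y ≢ 0# → (x * y) † ≡ x † + y †
  †-mul {x} {y} x≢0 y≢0 = †-unique (*-≢0 x≢0 y≢0) (begin
    (x * y) * (x † + y †)         ≡⟨ solve 4 (λ x y a b → (x :* y) :* (a :+ b) := y :* (x :* a) :+ x :* (y :* b))
                                       refl x y (x †) (y †) ⟩
    y * (x * x †) + x * (y * y †) ≡⟨ cong₂ (λ s t → y * s + x * t) (†-spec x≢0) (†-spec y≢0) ⟩
    y * ∂ x + x * ∂ y             ≡⟨ solve 4 (λ x y dx dy → y :* dx :+ x :* dy := dx :* y :+ x :* dy)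
                                       refl x y (∂ x) (∂ y) ⟩
    ∂ x * y + x * ∂ y             ≡⟨ sym (∂-* x y) ⟩
    ∂ (x * y)                     ∎)

  †-one : 1# † ≡ 0#
  †-one = †-unique 1≢0 (trans (solve 0 (1ᶜ :* 0ᶜ := 0ᶜ) refl) (sym ∂-one))

  †-inv : ∀ {x} → x ≢ 0# → (x ⁻¹) † ≡ - (x †)
  †-inv {x} x≢0 = +-inverseʳ-unique (x †) ((x ⁻¹) †) (begin
    x † + (x ⁻¹) †  ≡⟨ sym (†-mul x≢0 (⁻¹-≢0 x≢0)) ⟩
    (x * x ⁻¹) †    ≡⟨ cong _† (inverseʳ x x≢0) ⟩
    1# †            ≡⟨ †-one ⟩
    0#              ∎)

  †-inv-≢0 : ∀ {x} → x ≢ 0# → x † ≢ 0# → (x ⁻¹) † ≢ 0#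
  †-inv-≢0 x≢0 x†≢0 x⁻¹†≡0 = neg-≢0 x†≢0 (trans (sym (†-inv x≢0)) x⁻¹†≡0)

  †-neg : ∀ {x} → x ≢ 0# → (- x) † ≡ x †
  †-neg {x} x≢0 = †-unique (neg-≢0 x≢0) (begin
    - x * x †      ≡⟨ solve 2 (λ x a → :- x :* a := :- (x :* a)) refl x (x †) ⟩
    - (x * x †)    ≡⟨ cong -_ (†-spec x≢0) ⟩
    - ∂ x          ≡⟨ sym (∂-neg x) ⟩
    ∂ (- x)        ∎)

  †≢0⇒∂≢0 : ∀ {x} → x † ≢ 0# → ∂ x ≢ 0#
  †≢0⇒∂≢0 {x} x†≢0 ∂x≡0 =
    x†≢0 (trans (cong (_* x ⁻¹) ∂x≡0) (solve 1 (λ i → 0ᶜ :* i := 0ᶜ) refl (x ⁻¹)))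

  ∂≢0⇒≢0 : ∀ {x} → ∂ x ≢ 0# → x ≢ 0#
  ∂≢0⇒≢0 ∂x≢0 x≡0 = ∂x≢0 (trans (cong ∂ x≡0) ∂-zero)

  ∂≢0⇒†≢0 : ∀ {x} → x ≢ 0# → ∂ x ≢ 0# → x † ≢ 0#
  ∂≢0⇒†≢0 {x} x≢0 ∂x≢0 x†≡0 = ∂x≢0 (begin
    ∂ x       ≡⟨ sym (†-spec x≢0) ⟩
    x * x †   ≡⟨ cong (x *_) x†≡0 ⟩
    x * 0#    ≡⟨ solve 1 (λ x → x :* 0ᶜ := 0ᶜ) refl x ⟩
    0#        ∎)

module ValuationFacts (F : OrderedValuedDiffField) where
  open OrderedValuedDiffField F
  open OrderedFieldFacts F
  open DerivationFacts F using (†-spec; †-inv)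
  open IntegerCoefficientSolver isCommutativeRing using (solve; _:*_; :-_; _:=_; 1ᶜ)
  open OrderedAbelianGroup Γ using (0g) renaming (_+_ to _⊕_; -_ to ⊝_; _<_ to _<Γ_)
  private module VG = OrderedGroupFacts Γ
  open ≡-Reasoning

  -- the nonzeroness proof is irrelevant, so v respects equality
  v-cong : ∀ {x y} .(x≢0 : x ≢ 0#) .(y≢0 : y ≢ 0#) → x ≡ y → v x x≢0 ≡ v y y≢0
  v-cong _ _ refl = refl

  v-* : ∀ {x y} (x≢0 : x ≢ 0#) (y≢0 : y ≢ 0#) .(xy≢0 : x * y ≢ 0#) →
        v (x * y) xy≢0 ≡ v x x≢0 ⊕ v y y≢0
  v-* x≢0 y≢0 _ = v-mul _ _ x≢0 y≢0 (*-≢0 x≢0 y≢0)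

  v-one : ∀ .(1≢0' : 1# ≢ 0#) → v 1# 1≢0' ≡ 0g
  v-one _ = VG.identityʳ-unique (v 1# 1≢0) (v 1# 1≢0) (sym (begin
    v 1# 1≢0                ≡⟨ v-cong 1≢0 (*-≢0 1≢0 1≢0) (solve 0 (1ᶜ := 1ᶜ :* 1ᶜ) refl) ⟩
    v (1# * 1#) _           ≡⟨ v-* 1≢0 1≢0 _ ⟩
    v 1# 1≢0 ⊕ v 1# 1≢0     ∎))

  v-inv : ∀ {x} (x≢0 : x ≢ 0#) .(x⁻¹≢0 : x ⁻¹ ≢ 0#) → v (x ⁻¹) x⁻¹≢0 ≡ ⊝ v x x≢0
  v-inv {x} x≢0 _ = VG.inverseʳ-unique (v x x≢0) (v (x ⁻¹) (⁻¹-≢0 x≢0)) (begin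
    v x x≢0 ⊕ v (x ⁻¹) _    ≡⟨ sym (v-* x≢0 (⁻¹-≢0 x≢0) (*-≢0 x≢0 (⁻¹-≢0 x≢0))) ⟩
    v (x * x ⁻¹) _          ≡⟨ v-cong (*-≢0 x≢0 (⁻¹-≢0 x≢0)) 1≢0 (inverseʳ x x≢0) ⟩
    v 1# 1≢0                ≡⟨ v-one 1≢0 ⟩
    0g                      ∎)

  -- (-1)² = 1, so v(-1) = 0 since Γ is torsion-free
  v-neg : ∀ {x} (x≢0 : x ≢ 0#) .(-x≢0 : - x ≢ 0#) → v (- x) -x≢0 ≡ v x x≢0
  v-neg {x} x≢0 _ = begin
    v (- x) _                  ≡⟨ v-cong (neg-≢0 x≢0) (*-≢0 -1≢0 x≢0) (solve 1 (λ x → :- x := :- 1ᶜ :* x) refl x) ⟩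
    v (- 1# * x) _             ≡⟨ v-* -1≢0 x≢0 _ ⟩
    v (- 1#) -1≢0 ⊕ v x x≢0    ≡⟨ cong (_⊕ v x x≢0) v-minus-one ⟩
    0g ⊕ v x x≢0               ≡⟨ VG.identityˡ _ ⟩
    v x x≢0                    ∎
    where
      -1≢0 : - 1# ≢ 0#
      -1≢0 = neg-≢0 1≢0
      v-minus-one : v (- 1#) -1≢0 ≡ 0g
      v-minus-one = VG.double≡0⇒≡0 (begin
        v (- 1#) -1≢0 ⊕ v (- 1#) -1≢0  ≡⟨ sym (v-* -1≢0 -1≢0 (*-≢0 -1≢0 -1≢0)) ⟩
        v (- 1# * - 1#) _              ≡⟨ v-cong (*-≢0 -1≢0 -1≢0) 1≢0 (solve 0 (:- 1ᶜ :* :- 1ᶜ := 1ᶜ) refl) ⟩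
        v 1# 1≢0                       ≡⟨ v-one 1≢0 ⟩
        0g                             ∎)

  v-⁻¹-pos : ∀ {x} (x≢0 : x ≢ 0#) .(x⁻¹≢0 : x ⁻¹ ≢ 0#) → v x x≢0 <Γ 0g → 0g <Γ v (x ⁻¹) x⁻¹≢0
  v-⁻¹-pos x≢0 x⁻¹≢0 vx<0 = subst (0g <Γ_) (sym (v-inv x≢0 x⁻¹≢0)) (VG.neg-of-neg vx<0)

  v-†-inv : ∀ {x} (x≢0 : x ≢ 0#) (x†≢0 : x † ≢ 0#) .(x⁻¹†≢0 : (x ⁻¹) † ≢ 0#) →
            v ((x ⁻¹) †) x⁻¹†≢0 ≡ v (x †) x†≢0
  v-†-inv x≢0 x†≢0 x⁻¹†≢0 = trans (v-cong x⁻¹†≢0 (neg-≢0 x†≢0) (†-inv x≢0)) (v-neg x†≢0 _)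

  v-∂ : ∀ {y} (y≢0 : y ≢ 0#) .(∂y≢0 : ∂ y ≢ 0#) (y†≢0 : y † ≢ 0#) →
        v (∂ y) ∂y≢0 ≡ v y y≢0 ⊕ v (y †) y†≢0
  v-∂ y≢0 ∂y≢0 y†≢0 = trans (v-cong ∂y≢0 (*-≢0 y≢0 y†≢0) (sym (†-spec y≢0))) (v-* y≢0 y†≢0 _)

  positive-of-value : ∀ γ → Σ K λ y → (0# < y) × Σ (y ≢ 0#) λ y≢0 → v y y≢0 ≡ γ
  positive-of-value γ with v-surj γ
  ... | x , x≢0 , vx≡γ with pos-or-neg-pos x≢0
  ...   | inj₁ 0<x  = x , 0<x , x≢0 , vx≡γ
  ...   | inj₂ 0<-x = - x , 0<-x , neg-≢0 x≢0 , trans (v-neg x≢0 _) vx≡γ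

module FirstOrderEquations (F : OrderedValuedDiffField) where
  open OrderedValuedDiffField F
  open OrderedFieldFacts F
  open DerivationFacts F using (†-unique)
  open IntegerCoefficientSolver isCommutativeRing using (solve; _:+_; _:*_; :-_; _:=_; 0ᶜ; 1ᶜ)
  open ≡-Reasoning

  negate : DiffPoly1 → DiffPoly1
  negate []                = []
  negate ((c , i , j) ∷ P) = (- c , i , j) ∷ negate P

  eval-negate : ∀ P t → eval1 (negate P) t ≡ - eval1 P t
  eval-negate [] t = solve 0 (0ᶜ := :- 0ᶜ) refl
  eval-negate ((c , i , j) ∷ P) t = begin
    - c * pow t i * pow (∂ t) j + eval1 (negate P) t  ≡⟨ cong (- c * pow t i * pow (∂ t) j +_) (eval-negate P t) ⟩
    - c * pow t i * pow (∂ t) j + - eval1 P t         ≡⟨ solve 4 (λ c x y e → :- c :* x :* y :+ :- e := :- (c :* x :* y :+ e))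
                                                           refl c (pow t i) (pow (∂ t) j) (eval1 P t) ⟩
    - (c * pow t i * pow (∂ t) j + eval1 P t)         ∎

  Between : K → K → K → Set
  Between f g φ = (f < φ × φ < g) ⊎ (g < φ × φ < f)

  -- 1-IVP without the requirement f < g: if g < f, apply it to -P
  ivp-between : Has1IVP F → ∀ P f g → eval1 P f < 0# → 0# < eval1 P g →
                Σ K λ φ → Between f g φ × (eval1 P φ ≡ 0#)
  ivp-between ivp P f g Pf<0 0<Pg with compare f g
  ... | tri< f<g _ _ with ivp P f g f<g Pf<0 0<Pg
  ...   | φ , f<φ , φ<g , Pφ≡0 = φ , inj₁ (f<φ , φ<g) , Pφ≡0
  ivp-between ivp P f g Pf<0 0<Pg | tri≈ _ f≡g _ =
    ⊥-elim (<-asym Pf<0 (subst (λ t → 0# < eval1 P t) (sym f≡g) 0<Pg))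
  ivp-between ivp P f g Pf<0 0<Pg | tri> _ _ g<f
    with ivp (negate P) g f g<f (subst (_< 0#) (sym (eval-negate P g)) (neg-of-pos 0<Pg))
                                (subst (0# <_) (sym (eval-negate P f)) (neg-of-neg Pf<0))
  ... | φ , g<φ , φ<f , -Pφ≡0 = φ , inj₂ (g<φ , φ<f) , (begin
    eval1 P φ           ≡⟨ solve 1 (λ e → e := :- (:- e)) refl (eval1 P φ) ⟩
    - (- eval1 P φ)     ≡⟨ cong -_ (trans (sym (eval-negate P φ)) -Pφ≡0) ⟩
    - 0#                ≡⟨ solve 0 (:- 0ᶜ := 0ᶜ) refl ⟩
    0#                  ∎)

  antiderivativeEq : K → DiffPoly1
  antiderivativeEq a = (1# , 0 , 1) ∷ (- a , 0 , 0) ∷ []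

  eval-antiderivativeEq : ∀ a t → eval1 (antiderivativeEq a) t ≡ ∂ t + - a
  eval-antiderivativeEq a t = solve 2 (λ d a → 1ᶜ :* 1ᶜ :* (d :* 1ᶜ) :+ (:- a :* 1ᶜ :* 1ᶜ :+ 0ᶜ) := d :+ :- a)
                                refl (∂ t) a

  zero-of-antiderivativeEq : ∀ {a φ} → eval1 (antiderivativeEq a) φ ≡ 0# → ∂ φ ≡ a
  zero-of-antiderivativeEq {a} {φ} Pφ≡0 = begin
    ∂ φ               ≡⟨ solve 2 (λ d a → d := (d :+ :- a) :+ a) refl (∂ φ) a ⟩
    (∂ φ + - a) + a   ≡⟨ cong (_+ a) (trans (sym (eval-antiderivativeEq a φ)) Pφ≡0) ⟩
    0# + a            ≡⟨ solve 1 (λ a → 0ᶜ :+ a := a) refl a ⟩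
    a                 ∎

  logDerivativeEq : K → DiffPoly1
  logDerivativeEq c = (1# , 0 , 1) ∷ (- c , 1 , 0) ∷ []

  eval-logDerivativeEq : ∀ c t → eval1 (logDerivativeEq c) t ≡ ∂ t + - (c * t)
  eval-logDerivativeEq c t =
    solve 3 (λ d c t → 1ᶜ :* 1ᶜ :* (d :* 1ᶜ) :+ (:- c :* (t :* 1ᶜ) :* 1ᶜ :+ 0ᶜ) := d :+ :- (c :* t))
      refl (∂ t) c t

  zero-of-logDerivativeEq : ∀ {c φ} → φ ≢ 0# → eval1 (logDerivativeEq c) φ ≡ 0# → φ † ≡ c
  zero-of-logDerivativeEq {c} {φ} φ≢0 Pφ≡0 = †-unique φ≢0 (begin
    φ * c                          ≡⟨ solve 3 (λ φ c d → φ :* c := d :+ :- (d :+ :- (c :* φ))) refl φ c (∂ φ) ⟩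
    ∂ φ + - (∂ φ + - (c * φ))      ≡⟨ cong (λ t → ∂ φ + - t) (trans (sym (eval-logDerivativeEq c φ)) Pφ≡0) ⟩
    ∂ φ + - 0#                     ≡⟨ solve 1 (λ d → d :+ :- 0ᶜ := d) refl (∂ φ) ⟩
    ∂ φ                            ∎)

module LogarithmicDerivatives (F : OrderedValuedDiffField) where
  open OrderedValuedDiffField F
  open OrderedFieldFacts F
  open DerivationFacts F
  open FirstOrderEquations F
  open IntegerCoefficientSolver isCommutativeRing using (solve; _:+_; _:*_; :-_; _:=_)
  open ≡-Reasoning

  -- (-f)† = f†, and f ↦ -f swaps K^> and K^<
  pos†⇒neg† : ∀ a → DagPos F a → DagNeg F a
  pos†⇒neg† a (f , 0<f , f†≡a) = - f , neg-of-pos 0<f , trans (†-neg (pos⇒≢0 0<f)) f†≡a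

  neg†⇒pos† : ∀ a → DagNeg F a → DagPos F a
  neg†⇒pos† a (f , f<0 , f†≡a) = - f , neg-of-neg f<0 , trans (†-neg (neg⇒≢0 f<0)) f†≡a

  nonzero†-is-pos† : ∀ {x} → x ≢ 0# → DagPos F (x †)
  nonzero†-is-pos† {x} x≢0 with pos-or-neg-pos x≢0
  ... | inj₁ 0<x  = x , 0<x , refl
  ... | inj₂ 0<-x = - x , 0<-x , †-neg x≢0

  -- f ↦ f† is a homomorphism K^> → K, so its image is a subgroup
  pos†-zero : DagPos F 0#
  pos†-zero = 1# , 0<1 , †-one

  pos†-+ : ∀ a b → DagPos F a → DagPos F b → DagPos F (a + b)
  pos†-+ a b (f , 0<f , f†≡a) (g , 0<g , g†≡b) =
    f * g , *-pos 0<f 0<g , trans (†-mul (pos⇒≢0 0<f) (pos⇒≢0 0<g)) (cong₂ _+_ f†≡a g†≡b)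

  pos†-neg : ∀ a → DagPos F a → DagPos F (- a)
  pos†-neg a (f , 0<f , f†≡a) = f ⁻¹ , ⁻¹-pos 0<f , trans (†-inv (pos⇒≢0 0<f)) (cong -_ f†≡a)

  logDerivativeEq-at : ∀ c {f} → f ≢ 0# → eval1 (logDerivativeEq c) f ≡ f * (f † + - c)
  logDerivativeEq-at c {f} f≢0 = begin
    eval1 (logDerivativeEq c) f ≡⟨ eval-logDerivativeEq c f ⟩
    ∂ f + - (c * f)             ≡⟨ cong (λ t → t + - (c * f)) (sym (†-spec f≢0)) ⟩
    f * f † + - (c * f)         ≡⟨ solve 3 (λ f a c → f :* a :+ :- (c :* f) := f :* (a :+ :- c)) refl f (f †) c ⟩
    f * (f † + - c)             ∎

  -- With 1-IVP, if f† < c < g† with f, g > 0, then Y' - cY is negative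
  -- at f and positive at g, and a zero φ between f and g is positive
  -- with φ† = c.
  †-between : Has1IVP F → ∀ {f g c} → 0# < f → 0# < g → f † < c → c < g † → DagPos F c
  †-between ivp {f} {g} {c} 0<f 0<g f†<c c<g† =
    let (φ , between , Pφ≡0) = ivp-between ivp (logDerivativeEq c) f g Pf<0 0<Pg
    in  φ , 0<φ between , zero-of-logDerivativeEq (pos⇒≢0 (0<φ between)) Pφ≡0
    where
      Pf<0 : eval1 (logDerivativeEq c) f < 0#
      Pf<0 = subst (_< 0#) (sym (logDerivativeEq-at c (pos⇒≢0 0<f))) (pos*neg<0 0<f (<⇒difference<0 f†<c))
      0<Pg : 0# < eval1 (logDerivativeEq c) g
      0<Pg = subst (0# <_) (sym (logDerivativeEq-at c (pos⇒≢0 0<g))) (*-pos 0<g (<⇒0<difference c<g†))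
      0<φ : ∀ {φ} → Between f g φ → 0# < φ
      0<φ (inj₁ (f<φ , _)) = <-trans 0<f f<φ
      0<φ (inj₂ (g<φ , _)) = <-trans 0<g g<φ

  †-convex : Has1IVP F → ∀ a b c → DagPos F a → DagPos F b → a ≤ c → c ≤ b → DagPos F c
  †-convex ivp a b c (f , 0<f , f†≡a) _ (inj₂ a≡c) _ = f , 0<f , trans f†≡a a≡c
  †-convex ivp a b c _ (g , 0<g , g†≡b) (inj₁ _) (inj₂ c≡b) = g , 0<g , trans g†≡b (sym c≡b)
  †-convex ivp a b c (f , 0<f , f†≡a) (g , 0<g , g†≡b) (inj₁ a<c) (inj₁ c<b) =
    †-between ivp 0<f 0<g (subst (_< c) (sym f†≡a) a<c) (subst (c <_) (sym g†≡b) c<b)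

  †-convex-subgroup : Has1IVP F → IsConvexSubgroup F (DagPos F)
  †-convex-subgroup ivp = pos†-zero , pos†-+ , pos†-neg , †-convex ivp

module PreHFieldFacts (PF : PreHField) where
  open PreHField PF
  open IsPreHField isPreH
  open OrderedFieldFacts field'
  open ValuationFacts field'
  open OrderedAbelianGroup Γ using (0g)
    renaming (_+_ to _⊕_; -_ to ⊝_; _<_ to _<Γ_; _≤_ to _≤Γ_; +-mono-< to ⊕-mono-<)
  open IntegerCoefficientSolver isCommutativeRing using (solve; :-_; _:=_)
  private module VG = OrderedGroupFacts Γ

  ≼1-intro : ∀ {x} (x≢0 : x ≢ 0#) → 0g ≤Γ v x x≢0 → x ≼ 1#
  ≼1-intro {x} x≢0 0≤vx = inj₂ (x≢0 , 1≢0 , subst (_≤Γ v x x≢0) (sym (v-one 1≢0)) 0≤vx)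

  ≼1-elim : ∀ {x} (x≢0 : x ≢ 0#) → x ≼ 1# → 0g ≤Γ v x x≢0
  ≼1-elim x≢0 (inj₁ x≡0) = ⊥-elim (x≢0 x≡0)
  ≼1-elim {x} x≢0 (inj₂ (_ , 1≢0' , v1≤vx)) = subst (_≤Γ v x x≢0) (v-one 1≢0') v1≤vx

  ≺1-intro : ∀ {x} (x≢0 : x ≢ 0#) → 0g <Γ v x x≢0 → x ≺ 1#
  ≺1-intro {x} x≢0 0<vx = 1≢0 , inj₂ (x≢0 , subst (_<Γ v x x≢0) (sym (v-one 1≢0)) 0<vx)

  -- Convexity of 𝒪 links valuation and order: if s > 0 and v s < v y,
  -- then y < s.  Otherwise 0 < s/y ≤ 1 puts s/y in 𝒪, yet v(s/y) < 0.
  dominated⇒below : ∀ {s y} (s≢0 : s ≢ 0#) (y≢0 : y ≢ 0#) → 0# < s → v s s≢0 <Γ v y y≢0 → y < s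
  dominated⇒below {s} {y} s≢0 y≢0 0<s vs<vy with compare y s
  ... | tri< y<s _ _ = y<s
  ... | tri≈ _ y≡s _ = ⊥-elim (VG.<-irrefl (subst (v s s≢0 <Γ_) (v-cong y≢0 s≢0 y≡s) vs<vy))
  ... | tri> _ _ s<y = ⊥-elim (VG.<-irrefl (VG.≤-<-trans (≼1-elim u≢0 u∈𝒪) vu<0))
    where
      0<y⁻¹ = ⁻¹-pos (<-trans 0<s s<y)
      u = s * y ⁻¹
      u≢0 : u ≢ 0#
      u≢0 = *-≢0 s≢0 (⁻¹-≢0 y≢0)
      u∈𝒪 : 𝒪 u
      u∈𝒪 = 𝒪-convex 0# 1# u (inj₁ refl) (≼1-intro 1≢0 (inj₂ (sym (v-one 1≢0))))
              (inj₁ (*-pos 0<s 0<y⁻¹))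
              (inj₁ (subst (u <_) (inverseʳ y y≢0) (*-monoʳ-< 0<y⁻¹ s<y)))
      vu<0 : v u u≢0 <Γ 0g
      vu<0 = subst₂ _<Γ_
        (sym (trans (v-* s≢0 (⁻¹-≢0 y≢0) u≢0) (cong (v s s≢0 ⊕_) (v-inv y≢0 (⁻¹-≢0 y≢0)))))
        (VG.inverseʳ (v y y≢0))
        (⊕-mono-< (⊝ v y y≢0) vs<vy)

  dominated⇒between : ∀ {s y} (s≢0 : s ≢ 0#) (y≢0 : y ≢ 0#) → 0# < s → v s s≢0 <Γ v y y≢0 →
                      (- s < y) × (y < s)
  dominated⇒between {s} {y} s≢0 y≢0 0<s vs<vy =
    subst (- s <_) (solve 1 (λ y → :- (:- y) := y) refl y) (neg-antitone -y<s) ,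
    dominated⇒below s≢0 y≢0 0<s vs<vy
    where
      -y<s : - y < s
      -y<s = dominated⇒below s≢0 (neg-≢0 y≢0) 0<s (subst (v s s≢0 <Γ_) (sym (v-neg y≢0 _)) vs<vy)

  -- a positive element of negative value lies above 𝒪, so its derivative is positive
  infinite⇒∂-pos : ∀ {y} (y≢0 : y ≢ 0#) → 0# < y → v y y≢0 <Γ 0g → 0# < ∂ y
  infinite⇒∂-pos {y} y≢0 0<y vy<0 = pos-deriv y above𝒪
    where
      above𝒪 : ∀ a → 𝒪 a → a < y
      above𝒪 a (inj₁ a≡0) = subst (_< y) (sym a≡0) 0<y
      above𝒪 a a∈𝒪@(inj₂ (a≢0 , _)) = dominated⇒below y≢0 a≢0 0<y (VG.<-≤-trans vy<0 (≼1-elim a≢0 a∈𝒪))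

  pdv-v : ∀ {f g} (f≢0 : f ≢ 0#) (g≢0 : g ≢ 0#) (∂f≢0 : ∂ f ≢ 0#) (g†≢0 : g † ≢ 0#) →
          f ≼ 1# → g ≺ 1# → v (g †) g†≢0 <Γ v (∂ f) ∂f≢0
  pdv-v f≢0 g≢0 ∂f≢0 g†≢0 f≼1 g≺1 with pdv _ _ f≢0 g≢0 f≼1 g≺1
  ... | _ , inj₁ ∂f≡0      = ⊥-elim (∂f≢0 ∂f≡0)
  ... | _ , inj₂ (_ , v<v) = v<v

module Antiderivatives (PF : PreHField) where
  open PreHField PF
  open OrderedFieldFacts field'
  open DerivationFacts field'
  open ValuationFacts field'
  open PreHFieldFacts PF
  open FirstOrderEquations field'
  open OrderedAbelianGroup Γ using (G; 0g) renaming (_+_ to _⊕_; -_ to ⊝_; _<_ to _<Γ_; _≤_ to _≤Γ_)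
  private module VG = OrderedGroupFacts Γ

  ψ-Bound : G → Set
  ψ-Bound C = ∀ {y} (y≢0 : y ≢ 0#) (y†≢0 : y † ≢ 0#) → v y y≢0 <Γ 0g → v (y †) y†≢0 <Γ C

  -- Such a bound exists once Γ^< ≠ ∅: take z > 0 with v z < 0 and f = z⁻¹;
  -- then (PDV) for f ≼ 1 and y⁻¹ ≺ 1 gives v(y†) = v((y⁻¹)†) < v(f').
  ψ-bounded : ∀ {w} → w <Γ 0g → Σ G ψ-Bound
  ψ-bounded {w} w<0 with positive-of-value w
  ... | z , 0<z , z≢0 , vz≡w = v (∂ f) ∂f≢0 , bound
    where
      vz<0 : v z z≢0 <Γ 0g
      vz<0 = subst (_<Γ 0g) (sym vz≡w) w<0
      f = z ⁻¹
      f≢0 = ⁻¹-≢0 z≢0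
      z†≢0 : z † ≢ 0#
      z†≢0 = ∂≢0⇒†≢0 z≢0 (pos⇒≢0 (infinite⇒∂-pos z≢0 0<z vz<0))
      ∂f≢0 : ∂ f ≢ 0#
      ∂f≢0 = †≢0⇒∂≢0 (†-inv-≢0 z≢0 z†≢0)
      f≼1 : f ≼ 1#
      f≼1 = ≼1-intro f≢0 (inj₁ (v-⁻¹-pos z≢0 f≢0 vz<0))
      bound : ψ-Bound (v (∂ f) ∂f≢0)
      bound {y} y≢0 y†≢0 vy<0 = subst (_<Γ v (∂ f) ∂f≢0) (v-†-inv y≢0 y†≢0 g†≢0)
                                  (pdv-v f≢0 g≢0 ∂f≢0 g†≢0 f≼1 (≺1-intro g≢0 (v-⁻¹-pos y≢0 g≢0 vy<0)))
        where
          g≢0 = ⁻¹-≢0 y≢0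
          g†≢0 = †-inv-≢0 y≢0 y†≢0

  -- If y > 0 and v y ≤ v a - C with v y < 0, then v(y') = v y + v(y†) < v a,
  -- so -y' < a < y'.
  derivative-dominates : ∀ {C} → ψ-Bound C → ∀ {a} (a≢0 : a ≢ 0#) {y} (y≢0 : y ≢ 0#) → 0# < y →
                         v y y≢0 <Γ 0g → v y y≢0 ≤Γ v a a≢0 ⊕ ⊝ C → (- ∂ y < a) × (a < ∂ y)
  derivative-dominates {C} ψ<C {a} a≢0 {y} y≢0 0<y vy<0 vy≤δ =
    dominated⇒between ∂y≢0 a≢0 0<∂y v∂y<va
    where
      0<∂y = infinite⇒∂-pos y≢0 0<y vy<0
      ∂y≢0 = pos⇒≢0 0<∂y
      y†≢0 = ∂≢0⇒†≢0 y≢0 ∂y≢0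
      v∂y<va : v (∂ y) ∂y≢0 <Γ v a a≢0
      v∂y<va = subst₂ _<Γ_ (sym (v-∂ y≢0 ∂y≢0 y†≢0)) (VG.sub-add C (v a a≢0))
                 (VG.+-mono-≤-< vy≤δ (ψ<C y≢0 y†≢0 vy<0))

  dominating-derivative : NontrivialValueGroup field' → ∀ {a} → a ≢ 0# →
                          Σ K λ y → (- ∂ y < a) × (a < ∂ y)
  dominating-derivative (_ , γ₀≢0) {a} a≢0 =
    let (w , w<0) = VG.negative-element γ₀≢0
        (C , ψ<C) = ψ-bounded w<0
        (γ , γ<0 , γ≤δ) = VG.negative-below (v a a≢0 ⊕ ⊝ C) w<0
        (y , 0<y , y≢0 , vy≡γ) = positive-of-value γ
    in  y , derivative-dominates ψ<C a≢0 y≢0 0<y (subst (_<Γ 0g) (sym vy≡γ) γ<0)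
                                  (subst (_≤Γ v a a≢0 ⊕ ⊝ C) (sym vy≡γ) γ≤δ)

  antiderivativeEq-at-neg : ∀ {a y} → - ∂ y < a → eval1 (antiderivativeEq a) (- y) < 0#
  antiderivativeEq-at-neg {a} {y} -∂y<a =
    subst (_< 0#) (sym (trans (eval-antiderivativeEq a (- y)) (cong (_+ - a) (∂-neg y))))
          (<⇒difference<0 -∂y<a)

  antiderivativeEq-at-pos : ∀ {a y} → a < ∂ y → 0# < eval1 (antiderivativeEq a) y
  antiderivativeEq-at-pos {a} {y} a<∂y =
    subst (0# <_) (sym (eval-antiderivativeEq a y)) (<⇒0<difference a<∂y)

  antiderivative : NontrivialValueGroup field' → Has1IVP field' → ∀ {a} → a ≢ 0# → Σ K λ b → ∂ b ≡ a
  antiderivative nt ivp {a} a≢0 =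
    let (y , -∂y<a , a<∂y) = dominating-derivative nt a≢0
        (φ , _ , Pφ≡0) = ivp-between ivp (antiderivativeEq a) (- y) y
                           (antiderivativeEq-at-neg -∂y<a) (antiderivativeEq-at-pos a<∂y)
    in  φ , zero-of-antiderivativeEq Pφ≡0

  ∂-surjective : NontrivialValueGroup field' → Has1IVP field' → ∀ a → Σ K λ b → ∂ b ≡ a
  ∂-surjective nt ivp a with compare a 0#
  ... | tri≈ _ a≡0 _ = 0# , trans ∂-zero (sym a≡0)
  ... | tri< a<0 _ _ = antiderivative nt ivp (neg⇒≢0 a<0)
  ... | tri> _ _ 0<a = antiderivative nt ivp (pos⇒≢0 0<a)

module PsiSet (PF : PreHField) where
  open PreHField PF
  open OrderedFieldFacts field'
  open DerivationFacts field'
  open ValuationFacts field'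
  open PreHFieldFacts PF
  open LogarithmicDerivatives field' using (nonzero†-is-pos†; pos†-neg; †-convex)
  open Antiderivatives PF using (∂-surjective)
  open OrderedAbelianGroup Γ using (G; 0g)
    renaming (_+_ to _⊕_; _<_ to _<Γ_; _≤_ to _≤Γ_; +-mono-< to ⊕-mono-<)
  private module VG = OrderedGroupFacts Γ

  -- since ψ(-γ) = ψ(γ), every δ ∈ Ψ is v(h†) for some h ≺ 1
  small-witness : ∀ {δ} → InΨ δ →
                  Σ K λ h → Σ (h ≢ 0#) λ h≢0 → (h ≺ 1#) × Σ (h † ≢ 0#) λ h†≢0 → v (h †) h†≢0 ≡ δ
  small-witness (g , g≢0 , vg≢0 , g†≢0 , vg†≡δ) with VG.compare (v g g≢0) 0g
  ... | tri> _ _ 0<vg = g , g≢0 , ≺1-intro g≢0 0<vg , g†≢0 , vg†≡δ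
  ... | tri≈ _ vg≡0 _ = ⊥-elim (vg≢0 vg≡0)
  ... | tri< vg<0 _ _ = g ⁻¹ , ⁻¹-≢0 g≢0 , ≺1-intro (⁻¹-≢0 g≢0) (v-⁻¹-pos g≢0 _ vg<0) ,
                        †-inv-≢0 g≢0 g†≢0 , trans (v-†-inv g≢0 g†≢0 _) vg†≡δ

  -- If y' = h† ≠ 0 with h ≺ 1, then v y < 0: otherwise y ≼ 1 and (PDV)
  -- would give v(h†) < v(y') = v(h†).
  antiderivative-of-small-† : ∀ {h y} (h≢0 : h ≢ 0#) (h†≢0 : h † ≢ 0#) → h ≺ 1# →
                              (y≢0 : y ≢ 0#) (∂y≢0 : ∂ y ≢ 0#) → ∂ y ≡ h † → v y y≢0 <Γ 0g
  antiderivative-of-small-† {h} {y} h≢0 h†≢0 h≺1 y≢0 ∂y≢0 ∂y≡h† with VG.<⊎≥ (v y y≢0) 0g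
  ... | inj₁ vy<0 = vy<0
  ... | inj₂ 0≤vy = ⊥-elim (VG.<-irrefl (subst (v (h †) h†≢0 <Γ_) (v-cong ∂y≢0 h†≢0 ∂y≡h†)
                      (pdv-v y≢0 h≢0 ∂y≢0 h†≢0 (≼1-intro y≢0 0≤vy) h≺1)))

  -- if v y < 0, then ψ(v y) = v(y') - v y lies in Ψ above v(y')
  ψ-above-v∂ : ∀ {y} (y≢0 : y ≢ 0#) (∂y≢0 : ∂ y ≢ 0#) → v y y≢0 <Γ 0g →
               Σ G λ δ' → InΨ δ' × (v (∂ y) ∂y≢0 <Γ δ')
  ψ-above-v∂ {y} y≢0 ∂y≢0 vy<0 = v (y †) y†≢0 , (y , y≢0 , vy≢0 , y†≢0 , refl) , v∂y<ψ
    where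
      y†≢0 = ∂≢0⇒†≢0 y≢0 ∂y≢0
      vy≢0 : v y y≢0 ≢ 0g
      vy≢0 vy≡0 = VG.<-irrefl (subst (_<Γ 0g) vy≡0 vy<0)
      v∂y<ψ : v (∂ y) ∂y≢0 <Γ v (y †) y†≢0
      v∂y<ψ = subst₂ _<Γ_ (sym (v-∂ y≢0 ∂y≢0 y†≢0)) (VG.identityˡ _)
                (⊕-mono-< (v (y †) y†≢0) vy<0)

  -- Ψ has no largest element: for δ = v(h†) with h ≺ 1 take y with y' = h†
  Ψ-no-max : NontrivialValueGroup field' → Has1IVP field' →
             ∀ δ → InΨ δ → Σ G λ δ' → InΨ δ' × (δ <Γ δ')
  Ψ-no-max nt ivp δ ψδ =
    let (h , h≢0 , h≺1 , h†≢0 , vh†≡δ) = small-witness ψδ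
        (y , ∂y≡h†) = ∂-surjective nt ivp (h †)
        ∂y≢0 : ∂ y ≢ 0#
        ∂y≢0 = λ ∂y≡0 → h†≢0 (trans (sym ∂y≡h†) ∂y≡0)
        y≢0 = ∂≢0⇒≢0 ∂y≢0
        vy<0 = antiderivative-of-small-† h≢0 h†≢0 h≺1 y≢0 ∂y≢0 ∂y≡h†
        (δ' , ψδ' , v∂y<δ') = ψ-above-v∂ y≢0 ∂y≢0 vy<0
    in  δ' , ψδ' , subst (_<Γ δ') (trans (v-cong ∂y≢0 h†≢0 ∂y≡h†) vh†≡δ) v∂y<δ'

  Ψ-positive-witness : ∀ {δ} → InΨ δ →
                       Σ K λ s → (0# < s) × Σ (s ≢ 0#) λ s≢0 → (v s s≢0 ≡ δ) × DagPos field' s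
  Ψ-positive-witness (g , g≢0 , _ , g†≢0 , vg†≡δ) with pos-or-neg-pos g†≢0
  ... | inj₁ 0<g†  = g † , 0<g† , g†≢0 , vg†≡δ , nonzero†-is-pos† g≢0
  ... | inj₂ 0<-g† = - (g †) , 0<-g† , neg-≢0 g†≢0 , trans (v-neg g†≢0 _) vg†≡δ ,
                     pos†-neg (g †) (nonzero†-is-pos† g≢0)

  -- An element y = h† (h > 0) of value c < b ∈ Ψ has c ∈ Ψ: write b = v(k†)
  -- with k ≺ 1; if v h = 0 then h ≼ 1 and (PDV) gives b < v(h') = c.
  pos†-below-Ψ : ∀ {b c} → InΨ b → c <Γ b → ∀ {y} (y≢0 : y ≢ 0#) → v y y≢0 ≡ c →
                 DagPos field' y → InΨ c
  pos†-below-Ψ {b} {c} ψb c<b {y} y≢0 vy≡c (h , 0<h , h†≡y) = h , h≢0 , vh≢0 , h†≢0 , vh†≡c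
    where
      h≢0 = pos⇒≢0 0<h
      h†≢0 : h † ≢ 0#
      h†≢0 h†≡0 = y≢0 (trans (sym h†≡y) h†≡0)
      ∂h≢0 = †≢0⇒∂≢0 h†≢0
      vh†≡c : v (h †) h†≢0 ≡ c
      vh†≡c = trans (v-cong h†≢0 y≢0 h†≡y) vy≡c
      vh≢0 : v h h≢0 ≢ 0g
      vh≢0 vh≡0 =
        let (k , k≢0 , k≺1 , k†≢0 , vk†≡b) = small-witness ψb
            v∂h≡c : v (∂ h) ∂h≢0 ≡ c
            v∂h≡c = trans (v-∂ h≢0 ∂h≢0 h†≢0) (trans (cong₂ _⊕_ vh≡0 vh†≡c) (VG.identityˡ c))
        in  VG.<-irrefl (VG.<-trans c<b (subst₂ _<Γ_ vk†≡b v∂h≡c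
              (pdv-v h≢0 k≢0 ∂h≢0 k†≢0 (≼1-intro h≢0 (inj₂ (sym vh≡0))) k≺1)))

  -- Ψ is convex: for a < c < b write a = v s with s > 0 in (K^>)† and take
  -- v y = c; then -s < y < s, so y ∈ (K^>)† by convexity.
  Ψ-convex : Has1IVP field' → ∀ a b c → InΨ a → InΨ b → a ≤Γ c → c ≤Γ b → InΨ c
  Ψ-convex ivp a b c ψa ψb (inj₂ a≡c) _ = subst InΨ a≡c ψa
  Ψ-convex ivp a b c ψa ψb (inj₁ _) (inj₂ c≡b) = subst InΨ (sym c≡b) ψb
  Ψ-convex ivp a b c ψa ψb (inj₁ a<c) (inj₁ c<b) =
    let (s , 0<s , s≢0 , vs≡a , s∈S) = Ψ-positive-witness ψa
        (y , y≢0 , vy≡c) = v-surj c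
        (-s<y , y<s) = dominated⇒between s≢0 y≢0 0<s (subst₂ _<Γ_ (sym vs≡a) (sym vy≡c) a<c)
    in  pos†-below-Ψ ψb c<b y≢0 vy≡c
          (†-convex ivp (- s) s y (pos†-neg s s∈S) s∈S (inj₁ -s<y) (inj₁ y<s))

lemma1p1 : (F : PreHField) →
    NontrivialValueGroup (PreHField.field' F) →
    Has1IVP (PreHField.field' F) →
    Lemma1p1Conclusion (PreHField.field' F)
lemma1p1 F nt ivp =
  ∂-surjective nt ivp ,
  (λ a → pos†⇒neg† a , neg†⇒pos† a) ,
  †-convex-subgroup ivp ,
  Ψ-no-max nt ivp ,
  Ψ-convex ivp
  where
    open Antiderivatives F using (∂-surjective)
    open LogarithmicDerivatives (PreHField.field' F) using (pos†⇒neg†; neg†⇒pos†; †-convex-subgroup)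
    open PsiSet F using (Ψ-no-max; Ψ-convex)
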